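{- For every $n\ge 1$, the number $p_{n,2}$ of pop-stacked permutations of size $n$ with exactly two runs equals $2^n-2n$.
   Context: Runs of a permutation are its maximal increasing strings of consecutive entries; falls are its maximal decreasing strings of consecutive entries. The flip $T$ reverses every fall of a permutation in place. A permutation $\tau$ is pop-stacked if $\tau=T(\pi)$ for some permutation $\pi$. -}

module Defs where

open import Data.Nat using (ℕ; _<ᵇ_)
open import Data.Bool using (Bool; if_then_else_)
open import Data.List using (List; []; _∷_; [_]; concat; map; reverse; length; upTo)
open import Data.Product using (Σ; _×_)
open import Data.List.Relation.Binary.Permutation.Propositional using (_↭_)
open import Relation.Binary.PropositionalEquality using (_≡_)

-- A permutation of size n is a list containing each of 0,1,…,n-1 exactly once
-- (one-line notation, values shifted to start at 0).
IsPerm : ℕ → List ℕ → Set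
IsPerm n τ = τ ↭ upTo n

private
  prepend : (ℕ → ℕ → Bool) → ℕ → List (List ℕ) → List (List ℕ)
  prepend r x [] = [ x ] ∷ []
  prepend r x ([] ∷ gs) = [ x ] ∷ [] ∷ gs
  prepend r x ((y ∷ ys) ∷ gs) =
    if r x y then (x ∷ y ∷ ys) ∷ gs else [ x ] ∷ (y ∷ ys) ∷ gs

blocks : (ℕ → ℕ → Bool) → List ℕ → List (List ℕ)
blocks r [] = []
blocks r (x ∷ xs) = prepend r x (blocks r xs)

runs : List ℕ → List (List ℕ)
runs = blocks (λ a b → a <ᵇ b)

falls : List ℕ → List (List ℕ)
falls = blocks (λ a b → b <ᵇ a)

flipT : List ℕ → List ℕ
flipT π = concat (map reverse (falls π))

PopStacked : ℕ → List ℕ → Set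
PopStacked n τ = Σ (List ℕ) (λ π → IsPerm n π × flipT π ≡ τ)

module Submission where

-- A permutation τ of size n with exactly two runs is τ = A ++ B with A, B increasing and a
-- descent at the junction (min B < max A).  Such a τ is pop-stacked iff its runs overlap,
-- min A < max B: if they do, τ = T(reverse A ++ reverse B); conversely, whenever T(π) is cut
-- into two nonempty parts, some entry left of the cut is at most some entry right of it,
-- because the cut lies either inside a reversed fall (an increasing stretch) or between two
-- consecutive falls (which meet in an ascent).
-- Encoding τ by the word w ∈ {true,false}ⁿ carrying true exactly at the positions of A turns
-- the two conditions into the letter patterns false…true and true…false.  Words of length n
-- without false…true are true^k false^(n-k), so 2ⁿ - (n+1) words have that pattern; splitting
-- on the first letter, 2(2ⁿ - (n+1)) words of length n+1 have both, i.e. p_{n,2} = 2ⁿ - 2n.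

open import Defs
open import Data.Nat using (ℕ; zero; suc; pred; _+_; _*_; _^_; _∸_; _<ᵇ_; _<_; _≤_; _≥_; _≟_)
open import Data.Nat.Properties
  using (<-trans; <⇒≤; ≤-refl; ≤-trans; <-irrefl; <-asym; <⇒≱; ≤-antisym; <-≤-trans; ≤-<-trans; <ᵇ⇒<; <⇒<ᵇ; ≮⇒≥; ≤∧≢⇒<;
         m≤n⇒m≤1+n; +-identityʳ; +-assoc; +-comm; +-suc; m+n∸n≡m)
open import Data.Bool using (Bool; true; false; T; T?; not; _∧_; if_then_else_)
open import Data.Bool.Properties using (T-≡; T-∧; ∧-identityʳ; not-involutive)
open import Data.Unit using (tt)
open import Data.Empty using (⊥; ⊥-elim)
open import Data.Product using (Σ; ∃; ∃₂; _×_; _,_; proj₁; proj₂; map₁)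
open import Data.Sum using (_⊎_; inj₁; inj₂)
open import Data.List
  using (List; []; _∷_; _++_; _∷ʳ_; concat; map; reverse; length; upTo; applyUpTo; filterᵇ)
open import Data.List.Properties
  using (∷-injective; ∷-injectiveˡ; ∷-injectiveʳ; ++-identityʳ; ++-conicalʳ; unfold-reverse; reverse-involutive; length-map; length-++;
         length-upTo; map-∘; map-cong; map-id; filter-++)
open import Data.List.Relation.Unary.Linked as Linked using (Linked; []; [-]; _∷_)
open import Data.List.Relation.Unary.Linked.Properties using (AllPairs⇒Linked; Linked⇒AllPairs)
open import Data.List.Relation.Unary.All as All using (All; []; _∷_)
open import Data.List.Relation.Unary.AllPairs using (AllPairs; []; _∷_)
import Data.List.Relation.Unary.AllPairs.Properties as AllPairs
open import Data.List.Relation.Unary.All.Properties using () renaming (map⁺ to All-map⁺)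
open import Data.List.Relation.Unary.Any using (here; there)
import Data.List.Relation.Unary.Any.Properties as Any
open import Data.List.Relation.Unary.Unique.Propositional using (Unique)
import Data.List.Relation.Unary.Unique.Propositional.Properties as Unique
open import Data.List.Membership.Propositional using (_∈_)
open import Data.List.Membership.Propositional.Properties
  using (∉[]; ∈-++⁺ˡ; ∈-++⁺ʳ; ∈-++⁻; ∈-map⁺; ∈-map⁻; ∈-filter⁺; ∈-filter⁻)
open import Data.List.Relation.Binary.Permutation.Propositional
  using (_↭_; prep; ↭-refl; ↭-sym; ↭-trans; ↭⇒↭ₛ)
import Data.List.Relation.Binary.Permutation.Setoid.Properties
open import Data.List.Relation.Binary.Permutation.Propositional.Properties
  using (shift; ↭-reverse; ++⁺; ∈-resp-↭; All-resp-↭)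
open import Relation.Nullary using (¬_)
open import Relation.Nullary.Decidable using (isYes; toWitness; fromWitness; toWitnessFalse; fromWitnessFalse)
open import Data.List.Membership.DecPropositional _≟_ using (_∈?_)
open import Relation.Binary.PropositionalEquality
  using (_≡_; _≢_; setoid; refl; sym; trans; cong; cong₂; subst; subst₂; module ≡-Reasoning)
open import Function using (flip; _∘_)
open import Data.Nat.Solver using (module +-*-Solver)
open +-*-Solver using (solve; _:+_; _:*_; con; _:=_)
open import Function.Bundles using (_⇔_; mk⇔; Equivalence)

lastOf : ℕ → List ℕ → ℕ
lastOf x [] = x
lastOf x (y ∷ ys) = lastOf y ys

lastOf∈ : ∀ x xs → lastOf x xs ∈ x ∷ xs
lastOf∈ x [] = here refl
lastOf∈ x (y ∷ ys) = there (lastOf∈ y ys)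

lastOf-∷ʳ : ∀ y ys x → lastOf y (ys ∷ʳ x) ≡ x
lastOf-∷ʳ y [] x = refl
lastOf-∷ʳ y (z ∷ zs) x = lastOf-∷ʳ z zs x

reverse-shape : ∀ x xs → ∃ λ ys → reverse (x ∷ xs) ≡ lastOf x xs ∷ ys × lastOf (lastOf x xs) ys ≡ x
reverse-shape x [] = [] , refl , refl
reverse-shape x (x′ ∷ xs) with reverse-shape x′ xs
... | ys , e , _ = ys ∷ʳ x , trans (unfold-reverse x (x′ ∷ xs)) (cong (_∷ʳ x) e) , lastOf-∷ʳ _ ys x

AllPairs-across : ∀ {R : ℕ → ℕ → Set} xs {ys x y} → AllPairs R (xs ++ ys) → x ∈ xs → y ∈ ys → R x y
AllPairs-across (_ ∷ xs) (px ∷ _) (here refl) y∈ys = All.lookup px (∈-++⁺ʳ xs y∈ys)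
AllPairs-across (_ ∷ xs) (_ ∷ pxs) (there x∈xs) y∈ys = AllPairs-across xs pxs x∈xs y∈ys

AllPairs-reverse : ∀ {R : ℕ → ℕ → Set} {xs} → AllPairs R xs → AllPairs (flip R) (reverse xs)
AllPairs-reverse [] = []
AllPairs-reverse {xs = x ∷ xs} (px ∷ pxs) rewrite unfold-reverse x xs =
  AllPairs.++⁺ (AllPairs-reverse pxs) ([] ∷ [])
    (All.map (_∷ []) (All-resp-↭ (↭-sym (↭-reverse xs)) px))

split-++ : ∀ (xs ys A B : List ℕ) → xs ++ ys ≡ A ++ B →
  (∃ λ m → A ≡ xs ++ m × ys ≡ m ++ B) ⊎
  (∃₂ λ z m → xs ≡ A ++ z ∷ m × B ≡ z ∷ m ++ ys)
split-++ [] ys A B e = inj₁ (A , refl , e)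
split-++ (x ∷ xs) ys [] B e = inj₂ (x , xs , refl , sym e)
split-++ (x ∷ xs) ys (a ∷ A) B e with ∷-injective e
... | refl , e′ with split-++ xs ys A B e′
...   | inj₁ (m , p , q) = inj₁ (m , cong (x ∷_) p , q)
...   | inj₂ (z , m , p , q) = inj₂ (z , m , cong (x ∷_) p , q)

Unique-map : ∀ {A B : Set} (f : A → B) {xs} →
  (∀ {x y} → x ∈ xs → y ∈ xs → f x ≡ f y → x ≡ y) → Unique xs → Unique (map f xs)
Unique-map f inj [] = []
Unique-map f {x ∷ xs} inj (x∉ ∷ u) =
  All-map⁺ (All.tabulate λ y∈ fx≡fy → All.lookup x∉ y∈ (inj (here refl) (there y∈) fx≡fy))
    ∷ Unique-map f (λ p q → inj (there p) (there q)) u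

Increasing : List ℕ → Set
Increasing = AllPairs _<_

head≤ : ∀ {x xs z} → Increasing (x ∷ xs) → z ∈ x ∷ xs → x ≤ z
head≤ _ (here refl) = ≤-refl
head≤ (x< ∷ _) (there z∈) = <⇒≤ (All.lookup x< z∈)

≤lastOf : ∀ {x xs z} → Increasing (x ∷ xs) → z ∈ x ∷ xs → z ≤ lastOf x xs
≤lastOf {xs = []} _ (here refl) = ≤-refl
≤lastOf {xs = y ∷ ys} (x< ∷ inc) (here refl) = ≤-trans (<⇒≤ (All.lookup x< (here refl))) (≤lastOf inc (here refl))
≤lastOf {xs = y ∷ ys} (_ ∷ inc) (there z∈) = ≤lastOf inc z∈

increasing-ext : ∀ {xs ys} → Increasing xs → Increasing ys →
  (∀ {z} → z ∈ xs → z ∈ ys) → (∀ {z} → z ∈ ys → z ∈ xs) → xs ≡ ys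
increasing-ext {[]} {[]} _ _ _ _ = refl
increasing-ext {[]} {y ∷ ys} _ _ _ ys⊆ = ⊥-elim (∉[] (ys⊆ (here refl)))
increasing-ext {x ∷ xs} {[]} _ _ xs⊆ _ = ⊥-elim (∉[] (xs⊆ (here refl)))
increasing-ext {x ∷ xs} {y ∷ ys} ix@(x< ∷ inc-xs) iy@(y< ∷ inc-ys) xs⊆ ys⊆
  with ≤-antisym (head≤ ix (ys⊆ (here refl))) (head≤ iy (xs⊆ (here refl)))
... | refl = cong (x ∷_) (increasing-ext inc-xs inc-ys (tail⊆ x< xs⊆) (tail⊆ y< ys⊆))
  where
  -- the common head is smaller than every other entry, so the tails have the same entries
  tail⊆ : ∀ {us vs} → All (x <_) us → (∀ {z} → z ∈ x ∷ us → z ∈ x ∷ vs) → ∀ {z} → z ∈ us → z ∈ vs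
  tail⊆ x<us us⊆ z∈ with us⊆ (there z∈)
  ... | here refl = ⊥-elim (<-irrefl refl (All.lookup x<us z∈))
  ... | there z∈vs = z∈vs

module BlockDecomposition (r : ℕ → ℕ → Bool) where

  Chain : List ℕ → Set
  Chain = Linked (λ a b → T (r a b))

  data Blocking : List (List ℕ) → Set where
    none : Blocking []
    single : ∀ {x xs} → Chain (x ∷ xs) → Blocking ((x ∷ xs) ∷ [])
    cons : ∀ {x xs y ys gs} → Chain (x ∷ xs) → ¬ T (r (lastOf x xs) y) →
           Blocking ((y ∷ ys) ∷ gs) → Blocking ((x ∷ xs) ∷ (y ∷ ys) ∷ gs)

  private
    ¬T-false : ∀ {b} → b ≡ false → ¬ T b
    ¬T-false refl ()

    false-¬T : ∀ {b} → ¬ T b → b ≡ false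
    false-¬T {true} ¬t = ⊥-elim (¬t tt)
    false-¬T {false} _ = refl

  blocking-blocks : ∀ xs → Blocking (blocks r xs)
  blocking-blocks [] = none
  blocking-blocks (x ∷ xs) with blocks r xs | blocking-blocks xs
  ... | _ | none = single [-]
  ... | (y ∷ ys) ∷ [] | single c with r x y in rxy
  ...   | true = single (Equivalence.from T-≡ rxy ∷ c)
  ...   | false = cons [-] (¬T-false rxy) (single c)
  blocking-blocks (x ∷ xs) | (y ∷ ys) ∷ _ ∷ _ | cons c ¬r b with r x y in rxy
  ...   | true = cons (Equivalence.from T-≡ rxy ∷ c) ¬r b
  ...   | false = cons [-] (¬T-false rxy) (cons c ¬r b)

  concat-blocks : ∀ xs → concat (blocks r xs) ≡ xs
  concat-blocks [] = refl
  concat-blocks (x ∷ xs) with blocks r xs | concat-blocks xs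
  ... | [] | e = cong (x ∷_) e
  ... | [] ∷ _ | e = cong (x ∷_) e
  ... | (y ∷ _) ∷ _ | e with r x y
  ...   | true = cong (x ∷_) e
  ...   | false = cong (x ∷_) e

  blocks-concat : ∀ {gs} → Blocking gs → blocks r (concat gs) ≡ gs
  blocks-concat none = refl
  blocks-concat (single [-]) = refl
  blocks-concat (single (rxy ∷ c)) rewrite blocks-concat (single c) | Equivalence.to T-≡ rxy = refl
  blocks-concat (cons [-] ¬r b) rewrite blocks-concat b | false-¬T ¬r = refl
  blocks-concat (cons (rxy ∷ c) ¬r b) rewrite blocks-concat (cons c ¬r b) | Equivalence.to T-≡ rxy = refl

  blocks-pair : ∀ {x xs y ys} → Chain (x ∷ xs) → Chain (y ∷ ys) → ¬ T (r (lastOf x xs) y) →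
    blocks r ((x ∷ xs) ++ (y ∷ ys)) ≡ (x ∷ xs) ∷ (y ∷ ys) ∷ []
  blocks-pair {x} {xs} {y} {ys} cx cy ¬r =
    subst (λ zs → blocks r ((x ∷ xs) ++ zs) ≡ (x ∷ xs) ∷ (y ∷ ys) ∷ []) (++-identityʳ (y ∷ ys))
      (blocks-concat (cons cx ¬r (single cy)))

module Runs = BlockDecomposition (λ a b → a <ᵇ b)
module Falls = BlockDecomposition (λ a b → b <ᵇ a)
open BlockDecomposition using (none; single; cons)

run⇒increasing : ∀ {xs} → Runs.Chain xs → Increasing xs
run⇒increasing c = Linked⇒AllPairs <-trans (Linked.map (λ {a} {b} → <ᵇ⇒< a b) c)

increasing⇒run : ∀ {xs} → Increasing xs → Runs.Chain xs
increasing⇒run inc = Linked.map <⇒<ᵇ (AllPairs⇒Linked inc)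

fall⇒reverse-increasing : ∀ {xs} → Falls.Chain xs → Increasing (reverse xs)
fall⇒reverse-increasing c =
  AllPairs-reverse (Linked⇒AllPairs (λ p q → <-trans q p) (Linked.map (λ {a} {b} → <ᵇ⇒< b a) c))

increasing⇒reverse-fall : ∀ {xs} → Increasing xs → Falls.Chain (reverse xs)
increasing⇒reverse-fall inc = Linked.map <⇒<ᵇ (AllPairs⇒Linked (AllPairs-reverse inc))

runs-two : ∀ {a as c cs} → Increasing (a ∷ as) → Increasing (c ∷ cs) → c < lastOf a as →
  runs ((a ∷ as) ++ (c ∷ cs)) ≡ (a ∷ as) ∷ (c ∷ cs) ∷ []
runs-two ia ic c<last =
  Runs.blocks-pair (increasing⇒run ia) (increasing⇒run ic) (λ t → <-asym c<last (<ᵇ⇒< _ _ t))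

falls-two : ∀ {a as c cs} → Increasing (a ∷ as) → Increasing (c ∷ cs) → a ≤ lastOf c cs →
  falls (reverse (a ∷ as) ++ reverse (c ∷ cs)) ≡ reverse (a ∷ as) ∷ reverse (c ∷ cs) ∷ []
falls-two {a} {as} {c} {cs} ia ic a≤last
  with reverse (a ∷ as) | reverse-shape a as | increasing⇒reverse-fall ia
     | reverse (c ∷ cs) | reverse-shape c cs | increasing⇒reverse-fall ic
... | _ | ps , refl , last≡a | fa | _ | qs , refl , _ | fc =
  Falls.blocks-pair fa fc λ t → <⇒≱ (<ᵇ⇒< _ _ t) (subst (_≤ lastOf c cs) (sym last≡a) a≤last)

flip-two : ∀ {a as c cs} → Increasing (a ∷ as) → Increasing (c ∷ cs) → a ≤ lastOf c cs →
  flipT (reverse (a ∷ as) ++ reverse (c ∷ cs)) ≡ (a ∷ as) ++ (c ∷ cs)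
flip-two {a} {as} {c} {cs} ia ic a≤last = begin
  flipT (reverse A ++ reverse B)              ≡⟨ cong (λ gs → concat (map reverse gs)) (falls-two ia ic a≤last) ⟩
  reverse (reverse A) ++ reverse (reverse B) ++ [] ≡⟨ cong₂ _++_ (reverse-involutive A) (trans (++-identityʳ _) (reverse-involutive B)) ⟩
  A ++ B                                      ∎
  where
  open ≡-Reasoning
  A B : List ℕ
  A = a ∷ as
  B = c ∷ cs

record TwoBlockSplit (τ : List ℕ) : Set where
  constructor twoBlocks
  field
    a c : ℕ
    as cs : List ℕ
    first-increasing : Increasing (a ∷ as)
    second-increasing : Increasing (c ∷ cs)
    junction : c ≤ lastOf a as
    τ≡ : τ ≡ (a ∷ as) ++ (c ∷ cs)

two-runs⇒split : ∀ τ → length (runs τ) ≡ 2 → TwoBlockSplit τ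
two-runs⇒split τ = split (runs τ) (Runs.blocking-blocks τ) (Runs.concat-blocks τ)
  where
  split : ∀ {τ} gs → Runs.Blocking gs → concat gs ≡ τ → length gs ≡ 2 → TwoBlockSplit τ
  split ((a ∷ as) ∷ (c ∷ cs) ∷ []) (cons ca ¬asc (single cc)) refl refl =
    twoBlocks a c as cs (run⇒increasing ca) (run⇒increasing cc) (≮⇒≥ (λ lt → ¬asc (<⇒<ᵇ lt)))
      (cong ((a ∷ as) ++_) (++-identityʳ (c ∷ cs)))
  split [] none _ ()
  split (_ ∷ []) (single _) _ ()
  split (_ ∷ _ ∷ _ ∷ _) (cons _ _ (cons _ _ _)) _ ()

cut-inside-reversed-fall : ∀ {g B rest} → Falls.Chain g → ∀ A {a} → a ∈ A →
  (∃₂ λ z m → reverse g ≡ A ++ z ∷ m × B ≡ z ∷ m ++ rest) → ∃₂ λ x y → x ∈ A × y ∈ B × x ≤ y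
cut-inside-reversed-fall cg A {a} a∈ (z , m , rev≡ , B≡) =
  a , z , a∈ , subst (z ∈_) (sym B≡) (here refl) ,
  <⇒≤ (AllPairs-across A (subst Increasing rev≡ (fall⇒reverse-increasing cg)) a∈ (here refl))

-- A cut
-- inside a reversed fall lies in an increasing stretch; a cut between the reversed falls
-- g and h has the last entry of g left of it and the first entry of h right of it.
reversed-falls-cut : ∀ {gs} → Falls.Blocking gs → ∀ A B {a b} → a ∈ A → b ∈ B →
  concat (map reverse gs) ≡ A ++ B → ∃₂ λ x y → x ∈ A × y ∈ B × x ≤ y
reversed-falls-cut none [] B () b∈ e
reversed-falls-cut (single cg) A B {b = b} a∈ b∈ e with split-++ _ [] A B e
... | inj₁ (m , _ , []≡) = ⊥-elim (∉[] (subst (b ∈_) (++-conicalʳ m B (sym []≡)) b∈))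
... | inj₂ cut = cut-inside-reversed-fall cg A a∈ cut
reversed-falls-cut (cons {x} {xs} {y} {ys} cg ¬desc gs) A B a∈ b∈ e
  with split-++ (reverse (x ∷ xs)) _ A B e
... | inj₂ cut = cut-inside-reversed-fall cg A a∈ cut
... | inj₁ ([] , A≡ , rest≡) =
  lastOf x xs , y ,
  subst (lastOf x xs ∈_) (trans (sym (++-identityʳ _)) (sym A≡)) (Any.reverse⁺ (lastOf∈ x xs)) ,
  subst (y ∈_) rest≡ (∈-++⁺ˡ (Any.reverse⁺ {xs = y ∷ ys} (here refl))) ,
  ≮⇒≥ (λ lt → ¬desc (<⇒<ᵇ lt))
... | inj₁ (m ∷ ms , A≡ , rest≡) with reversed-falls-cut gs (m ∷ ms) B (here refl) b∈ rest≡
...   | u , v , u∈ , v∈ , u≤v = u , v , subst (u ∈_) (sym A≡) (∈-++⁺ʳ (reverse (x ∷ xs)) u∈) , v∈ , u≤v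

Below : List ℕ → List ℕ → Set
Below X Y = ∃₂ λ x y → x ∈ X × y ∈ Y × x < y

-- For increasing A and B, the runs of A ++ B are A and B as soon as some entry of B lies
-- below some entry of A (then min B < max A) …
interleaved⇒two-runs : ∀ {A B} → Increasing A → Increasing B → Below B A → runs (A ++ B) ≡ A ∷ B ∷ []
interleaved⇒two-runs {a ∷ as} {c ∷ cs} ia ic (x , y , x∈ , y∈ , x<y) =
  runs-two ia ic (≤-<-trans (head≤ ic x∈) (<-≤-trans x<y (≤lastOf ia y∈)))

-- … and A ++ B is a flip as soon as some entry of A lies below some entry of B
-- (then min A < max B).
interleaved⇒flip : ∀ {A B} → Increasing A → Increasing B → Below A B → flipT (reverse A ++ reverse B) ≡ A ++ B
interleaved⇒flip {a ∷ as} {c ∷ cs} ia ic (x , y , x∈ , y∈ , x<y) =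
  flip-two ia ic (≤-trans (head≤ ia x∈) (<⇒≤ (<-≤-trans x<y (≤lastOf ic y∈))))

perm-unique : ∀ {n τ} → IsPerm n τ → Unique τ
perm-unique τ↭ = PermProperties.Unique-resp-↭ (↭⇒↭ₛ (↭-sym τ↭)) (Unique.upTo⁺ _)
  where module PermProperties = Data.List.Relation.Binary.Permutation.Setoid.Properties (setoid ℕ)

-- Conversely, the two runs A, B of a pop-stacked permutation interleave in both directions:
-- the descent at the junction gives Below B A, and the cut lemma applied to the flip gives
-- Below A B (distinctness turns ≤ into <).
pop-stacked-runs-interleave : ∀ {n τ} → IsPerm n τ → PopStacked n τ → (s : TwoBlockSplit τ) →
  let open TwoBlockSplit s in Below (c ∷ cs) (a ∷ as) × Below (a ∷ as) (c ∷ cs)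
pop-stacked-runs-interleave τ↭ (π , _ , flip≡) (twoBlocks a c as cs ia ic c≤last refl)
  with reversed-falls-cut (Falls.blocking-blocks π) (a ∷ as) (c ∷ cs) (here refl) (here refl) flip≡
... | x , y , x∈ , y∈ , x≤y =
  (c , lastOf a as , here refl , lastOf∈ a as , ≤∧≢⇒< c≤last (λ c≡ → distinct (lastOf∈ a as) (here refl) (sym c≡))) ,
  (x , y , x∈ , y∈ , ≤∧≢⇒< x≤y (distinct x∈ y∈))
  where
  distinct : ∀ {x y} → x ∈ a ∷ as → y ∈ c ∷ cs → x ≢ y
  distinct = AllPairs-across (a ∷ as) (perm-unique τ↭)

-- A word w ∈ {true,false}ⁿ encodes the subset of positions carrying true.
-- select w k lists, increasingly, the positions (counted from k) at which w has true.
select : List Bool → ℕ → List ℕ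
select [] k = []
select (true ∷ w) k = k ∷ select w (suc k)
select (false ∷ w) k = select w (suc k)

complement : List Bool → List Bool
complement = map not

complement-involutive : ∀ w → complement (complement w) ≡ w
complement-involutive w = begin
  map not (map not w) ≡⟨ map-∘ w ⟨
  map (λ b → not (not b)) w ≡⟨ map-cong not-involutive w ⟩
  map (λ b → b) w ≡⟨ map-id w ⟩
  w ∎
  where open ≡-Reasoning

range : ℕ → ℕ → List ℕ
range k zero = []
range k (suc m) = k ∷ range (suc k) m

upTo≡range : ∀ n → upTo n ≡ range 0 n
upTo≡range n = applyUpTo-shift (λ i → i) 0 n (λ _ → refl)
  where
  applyUpTo-shift : ∀ f k m → (∀ i → f i ≡ k + i) → applyUpTo f m ≡ range k m
  applyUpTo-shift f k zero _ = refl
  applyUpTo-shift f k (suc m) f≡ =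
    cong₂ _∷_ (trans (f≡ 0) (+-identityʳ k))
      (applyUpTo-shift (λ i → f (suc i)) (suc k) m (λ i → trans (f≡ (suc i)) (+-suc k i)))

select-lower : ∀ w {m} k → m ≤ k → All (m ≤_) (select w k)
select-lower [] k _ = []
select-lower (true ∷ w) k m≤k = m≤k ∷ select-lower w (suc k) (m≤n⇒m≤1+n m≤k)
select-lower (false ∷ w) k m≤k = select-lower w (suc k) (m≤n⇒m≤1+n m≤k)

select-increasing : ∀ w k → Increasing (select w k)
select-increasing [] k = []
select-increasing (true ∷ w) k = select-lower w (suc k) ≤-refl ∷ select-increasing w (suc k)
select-increasing (false ∷ w) k = select-increasing w (suc k)

select-↭ : ∀ w k → select w k ++ select (complement w) k ↭ range k (length w)
select-↭ [] k = ↭-refl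
select-↭ (true ∷ w) k = prep k (select-↭ w (suc k))
select-↭ (false ∷ w) k =
  ↭-trans (shift k (select w (suc k)) (select (complement w) (suc k))) (prep k (select-↭ w (suc k)))

select-injective : ∀ w w′ k → length w ≡ length w′ → select w k ≡ select w′ k → w ≡ w′
select-injective [] [] k _ _ = refl
select-injective (true ∷ w) (true ∷ w′) k len e =
  cong (true ∷_) (select-injective w w′ (suc k) (cong pred len) (proj₂ (∷-injective e)))
select-injective (false ∷ w) (false ∷ w′) k len e =
  cong (false ∷_) (select-injective w w′ (suc k) (cong pred len) e)
select-injective (true ∷ w) (false ∷ w′) k _ e = ⊥-elim (k∉ w′ (subst (k ∈_) e (here refl)))
  where
  k∉ : ∀ v → k ∈ select v (suc k) → ⊥
  k∉ v k∈ = <-irrefl refl (All.lookup (select-lower v (suc k) ≤-refl) k∈)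
select-injective (false ∷ w) (true ∷ w′) k len e = sym (select-injective (true ∷ w′) (false ∷ w) k (sym len) (sym e))

select-map⁻ : ∀ (P : ℕ → Bool) k m {z} → z ∈ select (map P (range k m)) k → z ∈ range k m × T (P z)
select-map⁻ P k (suc m) z∈ with P k in Pk
select-map⁻ P k (suc m) (here refl) | true = here refl , subst T (sym Pk) tt
select-map⁻ P k (suc m) (there z∈) | true = map₁ there (select-map⁻ P (suc k) m z∈)
select-map⁻ P k (suc m) z∈ | false = map₁ there (select-map⁻ P (suc k) m z∈)

select-map⁺ : ∀ (P : ℕ → Bool) k m {z} → z ∈ range k m → T (P z) → z ∈ select (map P (range k m)) k
select-map⁺ P k (suc m) z∈ Pz with P k in Pk
select-map⁺ P k (suc m) (here refl) Pz | true = here refl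
select-map⁺ P k (suc m) (here refl) Pz | false = ⊥-elim (subst T Pk Pz)
select-map⁺ P k (suc m) (there z∈) Pz | true = there (select-map⁺ P (suc k) m z∈ Pz)
select-map⁺ P k (suc m) (there z∈) Pz | false = select-map⁺ P (suc k) m z∈ Pz

words : ℕ → List (List Bool)
words zero = [] ∷ []
words (suc n) = map (true ∷_) (words n) ++ map (false ∷_) (words n)

words-length : ∀ n {w} → w ∈ words n → length w ≡ n
words-length zero (here refl) = refl
words-length (suc n) w∈ with ∈-++⁻ (map (true ∷_) (words n)) w∈
... | inj₁ w∈t with ∈-map⁻ (true ∷_) w∈t
...   | v , v∈ , refl = cong suc (words-length n v∈)
words-length (suc n) w∈ | inj₂ w∈f with ∈-map⁻ (false ∷_) w∈f
...   | v , v∈ , refl = cong suc (words-length n v∈)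

∈-words : ∀ w → w ∈ words (length w)
∈-words [] = here refl
∈-words (true ∷ w) = ∈-++⁺ˡ (∈-map⁺ (true ∷_) (∈-words w))
∈-words (false ∷ w) = ∈-++⁺ʳ (map (true ∷_) (words (length w))) (∈-map⁺ (false ∷_) (∈-words w))

words-unique : ∀ n → Unique (words n)
words-unique zero = [] ∷ []
words-unique (suc n) =
  Unique.++⁺ (Unique.map⁺ ∷-injectiveʳ (words-unique n)) (Unique.map⁺ ∷-injectiveʳ (words-unique n)) disjoint
  where
  disjoint : ∀ {v} → v ∈ map (true ∷_) (words n) × v ∈ map (false ∷_) (words n) → ⊥
  disjoint (v∈t , v∈f) with ∈-map⁻ (true ∷_) v∈t | ∈-map⁻ (false ∷_) v∈f
  ... | _ , _ , refl | _ , _ , ()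

hasTrue : List Bool → Bool
hasTrue [] = false
hasTrue (true ∷ w) = true
hasTrue (false ∷ w) = hasTrue w

falseBeforeTrue : List Bool → Bool
falseBeforeTrue [] = false
falseBeforeTrue (true ∷ w) = falseBeforeTrue w
falseBeforeTrue (false ∷ w) = hasTrue w

select-hasTrue : ∀ w k → T (hasTrue w) → ∃ λ y → y ∈ select w k
select-hasTrue (true ∷ w) k _ = k , here refl
select-hasTrue (false ∷ w) k t = select-hasTrue w (suc k) t

hasTrue-select : ∀ w k {y} → y ∈ select w k → T (hasTrue w)
hasTrue-select (true ∷ w) k _ = tt
hasTrue-select (false ∷ w) k y∈ = hasTrue-select w (suc k) y∈

falseBeforeTrue⇔Below : ∀ w k → T (falseBeforeTrue w) ⇔ Below (select (complement w) k) (select w k)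
falseBeforeTrue⇔Below w k = mk⇔ (to w k) (from w k)
  where
  to : ∀ w k → T (falseBeforeTrue w) → Below (select (complement w) k) (select w k)
  to (true ∷ w) k t with to w (suc k) t
  ... | x , y , x∈ , y∈ , x<y = x , y , x∈ , there y∈ , x<y
  to (false ∷ w) k t with select-hasTrue w (suc k) t
  ... | y , y∈ = k , y , here refl , y∈ , All.lookup (select-lower w (suc k) ≤-refl) y∈
  from : ∀ w k → Below (select (complement w) k) (select w k) → T (falseBeforeTrue w)
  from (true ∷ w) k (x , .k , x∈ , here refl , x<k) =
    ⊥-elim (<-asym x<k (All.lookup (select-lower (complement w) (suc k) ≤-refl) x∈))
  from (true ∷ w) k (x , y , x∈ , there y∈ , x<y) = from w (suc k) (x , y , x∈ , y∈ , x<y)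
  from (false ∷ w) k (_ , _ , _ , y∈ , _) = hasTrue-select w (suc k) y∈

good : List Bool → Bool
good w = falseBeforeTrue w ∧ falseBeforeTrue (complement w)

ones zeros encode : List Bool → List ℕ
ones w = select w 0
zeros w = select (complement w) 0
encode w = ones w ++ zeros w

good⇔interleaved : ∀ w → T (good w) ⇔ (Below (zeros w) (ones w) × Below (ones w) (zeros w))
good⇔interleaved w = mk⇔
  (λ t → let t₁ , t₂ = Equivalence.to T-∧ t in
    Equivalence.to (falseBeforeTrue⇔Below w 0) t₁ ,
    subst (λ v → Below (select v 0) (zeros w)) (complement-involutive w)
      (Equivalence.to (falseBeforeTrue⇔Below (complement w) 0) t₂))
  (λ (b₁ , b₂) → Equivalence.from T-∧
    (Equivalence.from (falseBeforeTrue⇔Below w 0) b₁ ,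
     Equivalence.from (falseBeforeTrue⇔Below (complement w) 0)
       (subst (λ v → Below (select v 0) (zeros w)) (sym (complement-involutive w)) b₂)))

encode-perm : ∀ w → IsPerm (length w) (encode w)
encode-perm w = subst (encode w ↭_) (sym (upTo≡range (length w))) (select-↭ w 0)

encode-sound : ∀ n w → length w ≡ n → T (good w) →
  IsPerm n (encode w) × PopStacked n (encode w) × length (runs (encode w)) ≡ 2
encode-sound n w refl t =
  encode-perm w ,
  (reverse (ones w) ++ reverse (zeros w) ,
   ↭-trans (++⁺ (↭-reverse (ones w)) (↭-reverse (zeros w))) (encode-perm w) ,
   interleaved⇒flip incOnes incZeros B₂) ,
  cong length (interleaved⇒two-runs incOnes incZeros B₁)
  where
  incOnes : Increasing (ones w)
  incOnes = select-increasing w 0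
  incZeros : Increasing (zeros w)
  incZeros = select-increasing (complement w) 0
  B₁ : Below (zeros w) (ones w)
  B₁ = proj₁ (Equivalence.to (good⇔interleaved w) t)
  B₂ : Below (ones w) (zeros w)
  B₂ = proj₂ (Equivalence.to (good⇔interleaved w) t)

-- Good words of equal length are determined by their encodings (the first run is ones w).
encode-injective : ∀ {w w′} → T (good w) → T (good w′) → length w ≡ length w′ →
  encode w ≡ encode w′ → w ≡ w′
encode-injective {w} {w′} t t′ len e = select-injective w w′ 0 len (∷-injectiveˡ runs≡)
  where
  runs-encode : ∀ v → T (good v) → runs (encode v) ≡ ones v ∷ zeros v ∷ []
  runs-encode v tv = interleaved⇒two-runs (select-increasing v 0) (select-increasing (complement v) 0)
    (proj₁ (Equivalence.to (good⇔interleaved v) tv))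
  runs≡ : ones w ∷ zeros w ∷ [] ≡ ones w′ ∷ zeros w′ ∷ []
  runs≡ = trans (sym (runs-encode w t)) (trans (cong runs e) (runs-encode w′ t′))

indicator : List ℕ → ℕ → List Bool
indicator A n = map (λ i → isYes (i ∈? A)) (range 0 n)

indicator-split : ∀ n A B → IsPerm n (A ++ B) → Increasing A → Increasing B →
  ones (indicator A n) ≡ A × zeros (indicator A n) ≡ B
indicator-split n A B τ↭ ia ib =
  increasing-ext (select-increasing (map P (range 0 n)) 0) ia
    (λ z∈ → toWitness (proj₂ (select-map⁻ P 0 n z∈)))
    (λ z∈ → select-map⁺ P 0 n (in-range (∈-++⁺ˡ z∈)) (fromWitness z∈)) ,
  trans (cong (λ v → select v 0) (sym (map-∘ (range 0 n))))
    (increasing-ext (select-increasing (map (λ i → not (P i)) (range 0 n)) 0) ib outside-A⇒B B⇒outside-A)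
  where
  P : ℕ → Bool
  P i = isYes (i ∈? A)
  in-range : ∀ {z} → z ∈ A ++ B → z ∈ range 0 n
  in-range z∈ = subst (_ ∈_) (upTo≡range n) (∈-resp-↭ τ↭ z∈)
  from-range : ∀ {z} → z ∈ range 0 n → z ∈ A ++ B
  from-range z∈ = ∈-resp-↭ (↭-sym τ↭) (subst (_ ∈_) (sym (upTo≡range n)) z∈)
  outside-A⇒B : ∀ {z} → z ∈ select (map (λ i → not (P i)) (range 0 n)) 0 → z ∈ B
  outside-A⇒B z∈ with select-map⁻ (λ i → not (P i)) 0 n z∈
  ... | z∈r , z∉A with ∈-++⁻ A (from-range z∈r)
  ...   | inj₁ z∈A = ⊥-elim (toWitnessFalse z∉A z∈A)
  ...   | inj₂ z∈B = z∈B
  B⇒outside-A : ∀ {z} → z ∈ B → z ∈ select (map (λ i → not (P i)) (range 0 n)) 0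
  B⇒outside-A z∈ = select-map⁺ (λ i → not (P i)) 0 n (in-range (∈-++⁺ʳ A z∈))
    (fromWitnessFalse (λ z∈A → AllPairs-across A (perm-unique τ↭) z∈A z∈ refl))

encode-complete : ∀ n τ → IsPerm n τ → PopStacked n τ → length (runs τ) ≡ 2 →
  ∃ λ w → length w ≡ n × T (good w) × encode w ≡ τ
encode-complete n τ τ↭ pop two with two-runs⇒split τ two
... | s@(twoBlocks a c as cs ia ic _ refl) with pop-stacked-runs-interleave τ↭ pop s
...   | belowBA , belowAB =
  w , len , Equivalence.from (good⇔interleaved w) (subst₂ Below (sym zeros≡) (sym ones≡) belowBA ,
                                                   subst₂ Below (sym ones≡) (sym zeros≡) belowAB) ,
  cong₂ _++_ ones≡ zeros≡
  where
  w : List Bool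
  w = indicator (a ∷ as) n
  len : length w ≡ n
  len = trans (length-map _ (range 0 n)) (trans (cong length (sym (upTo≡range n))) (length-upTo n))
  ones≡ : ones w ≡ a ∷ as
  ones≡ = proj₁ (indicator-split n (a ∷ as) (c ∷ cs) τ↭ ia ic)
  zeros≡ : zeros w ≡ c ∷ cs
  zeros≡ = proj₂ (indicator-split n (a ∷ as) (c ∷ cs) τ↭ ia ic)

count : (List Bool → Bool) → ℕ → ℕ
count p zero = if p [] then 1 else 0
count p (suc n) = count (λ w → p (true ∷ w)) n + count (λ w → p (false ∷ w)) n

length-filter-words : ∀ p n → length (filterᵇ p (words n)) ≡ count p n
length-filter-words p zero with p []
... | true = refl
... | false = refl
length-filter-words p (suc n) = begin
  length (filterᵇ p (map (true ∷_) (words n) ++ map (false ∷_) (words n)))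
    ≡⟨ cong length (filter-++ (T? ∘ p) (map (true ∷_) (words n)) _) ⟩
  length (filterᵇ p (map (true ∷_) (words n)) ++ filterᵇ p (map (false ∷_) (words n)))
    ≡⟨ length-++ (filterᵇ p (map (true ∷_) (words n))) ⟩
  length (filterᵇ p (map (true ∷_) (words n))) + length (filterᵇ p (map (false ∷_) (words n)))
    ≡⟨ cong₂ _+_ (prefixed true) (prefixed false) ⟩
  count (λ w → p (true ∷ w)) n + count (λ w → p (false ∷ w)) n ∎
  where
  open ≡-Reasoning
  length-filter-prefix : ∀ b ws → length (filterᵇ p (map (b ∷_) ws)) ≡ length (filterᵇ (λ w → p (b ∷ w)) ws)
  length-filter-prefix b [] = refl
  length-filter-prefix b (w ∷ ws) with p (b ∷ w)
  ... | true = cong suc (length-filter-prefix b ws)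
  ... | false = length-filter-prefix b ws
  prefixed : ∀ b → length (filterᵇ p (map (b ∷_) (words n))) ≡ count (λ w → p (b ∷ w)) n
  prefixed b = trans (length-filter-prefix b (words n)) (length-filter-words (λ w → p (b ∷ w)) n)

count-cong : ∀ {p q} n → (∀ w → p w ≡ q w) → count p n ≡ count q n
count-cong {p} {q} zero p≡q rewrite p≡q [] = refl
count-cong (suc n) p≡q = cong₂ _+_ (count-cong n (λ w → p≡q (true ∷ w))) (count-cong n (λ w → p≡q (false ∷ w)))

count-complement : ∀ p n → count (λ w → p (complement w)) n ≡ count p n
count-complement p zero = refl
count-complement p (suc n) = trans
  (cong₂ _+_ (count-complement (λ w → p (false ∷ w)) n) (count-complement (λ w → p (true ∷ w)) n))
  (+-comm (count (λ w → p (false ∷ w)) n) _)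

double : ∀ x → x + x ≡ 2 * x
double x = cong (x +_) (sym (+-identityʳ x))

count-all : ∀ n → count (λ _ → true) n ≡ 2 ^ n
count-all zero = refl
count-all (suc n) = trans (cong₂ _+_ (count-all n) (count-all n)) (double (2 ^ n))

-- Only the all-false word lacks a true.
count-hasTrue : ∀ n → count hasTrue n + 1 ≡ 2 ^ n
count-hasTrue zero = refl
count-hasTrue (suc n) = begin
  count (λ _ → true) n + count hasTrue n + 1 ≡⟨ +-assoc (count (λ _ → true) n) _ 1 ⟩
  count (λ _ → true) n + (count hasTrue n + 1) ≡⟨ cong₂ _+_ (count-all n) (count-hasTrue n) ⟩
  2 ^ n + 2 ^ n ≡⟨ double (2 ^ n) ⟩
  2 ^ suc n ∎
  where open ≡-Reasoning

-- Only the n+1 words true…true false…false lack the pattern false…true.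
count-falseBeforeTrue : ∀ n → count falseBeforeTrue n + suc n ≡ 2 ^ n
count-falseBeforeTrue zero = refl
count-falseBeforeTrue (suc n) = begin
  f + h + (2 + n) ≡⟨ solve 3 (λ f h n → f :+ h :+ (con 2 :+ n) := f :+ (con 1 :+ n) :+ (h :+ con 1)) refl f h n ⟩
  (f + suc n) + (h + 1) ≡⟨ cong₂ _+_ (count-falseBeforeTrue n) (count-hasTrue n) ⟩
  2 ^ n + 2 ^ n ≡⟨ double (2 ^ n) ⟩
  2 ^ suc n ∎
  where
  open ≡-Reasoning
  f h : ℕ
  f = count falseBeforeTrue n
  h = count hasTrue n

good-true : ∀ w → falseBeforeTrue w ∧ hasTrue (complement w) ≡ falseBeforeTrue w
good-true [] = refl
good-true (true ∷ w) = good-true w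
good-true (false ∷ w) = ∧-identityʳ (hasTrue w)

good-false : ∀ w → hasTrue w ∧ falseBeforeTrue (complement w) ≡ falseBeforeTrue (complement w)
good-false [] = refl
good-false (true ∷ w) = refl
good-false (false ∷ w) = good-false w

count-good : ∀ n → count good (suc n) + 2 * suc n ≡ 2 ^ suc n
count-good n = begin
  count (λ w → good (true ∷ w)) n + count (λ w → good (false ∷ w)) n + 2 * suc n
    ≡⟨ cong (_+ 2 * suc n) (cong₂ _+_ (count-cong n good-true)
         (trans (count-cong n good-false) (count-complement falseBeforeTrue n))) ⟩
  f + f + 2 * suc n
    ≡⟨ solve 2 (λ f n → f :+ f :+ con 2 :* (con 1 :+ n) := f :+ (con 1 :+ n) :+ (f :+ (con 1 :+ n))) refl f n ⟩
  (f + suc n) + (f + suc n) ≡⟨ cong₂ _+_ (count-falseBeforeTrue n) (count-falseBeforeTrue n) ⟩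
  2 ^ n + 2 ^ n ≡⟨ double (2 ^ n) ⟩
  2 ^ suc n ∎
  where
  open ≡-Reasoning
  f : ℕ
  f = count falseBeforeTrue n

proposition5 : (n : ℕ) → n ≥ 1 →
    Σ (List (List ℕ)) (λ L →
      Unique L ×
      ((τ : List ℕ) → (τ ∈ L ⇔ (IsPerm n τ × PopStacked n τ × length (runs τ) ≡ 2))) ×
      length L ≡ 2 ^ n ∸ 2 * n)
proposition5 n@(suc m) _ =
  map encode goodWords ,
  Unique-map encode injective (Unique.filter⁺ (T? ∘ good) (words-unique n)) ,
  (λ τ → mk⇔ (sound τ) (complete τ)) ,
  (begin
    length (map encode goodWords) ≡⟨ length-map encode goodWords ⟩
    length goodWords              ≡⟨ length-filter-words good n ⟩
    count good n                  ≡⟨ m+n∸n≡m (count good n) (2 * n) ⟨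
    count good n + 2 * n ∸ 2 * n  ≡⟨ cong (_∸ 2 * n) (count-good m) ⟩
    2 ^ n ∸ 2 * n                 ∎)
  where
  open ≡-Reasoning
  goodWords : List (List Bool)
  goodWords = filterᵇ good (words n)
  injective : ∀ {w w′} → w ∈ goodWords → w′ ∈ goodWords → encode w ≡ encode w′ → w ≡ w′
  injective w∈ w′∈ with ∈-filter⁻ (T? ∘ good) w∈ | ∈-filter⁻ (T? ∘ good) w′∈
  ... | w∈n , t | w′∈n , t′ = encode-injective t t′ (trans (words-length n w∈n) (sym (words-length n w′∈n)))
  sound : ∀ τ → τ ∈ map encode goodWords → IsPerm n τ × PopStacked n τ × length (runs τ) ≡ 2
  sound τ τ∈ with ∈-map⁻ encode τ∈
  ... | w , w∈ , refl with ∈-filter⁻ (T? ∘ good) w∈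
  ...   | w∈n , t = encode-sound n w (words-length n w∈n) t
  complete : ∀ τ → IsPerm n τ × PopStacked n τ × length (runs τ) ≡ 2 → τ ∈ map encode goodWords
  complete τ (τ↭ , pop , two) with encode-complete n τ τ↭ pop two
  ... | w , len , t , refl = ∈-map⁺ encode (∈-filter⁺ (T? ∘ good) (subst (λ k → w ∈ words k) len (∈-words w)) t)
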